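{- Let $n\ge1$. The number of tree transpositions on $n$ elements (i.e. the number of triples $(i,j,k)$ with $1\le i<j<k\le n+1$ such that $\delta_{i,j,k}$ is a tree transposition) is $(n-1)^2$.
   Context: For a permutation $\sigma$ of $[n]$ and integers $1\le i<j<k\le n+1$, with $q=k+i-j$, the transposition $\delta_{i,j,k}$ applied to $\sigma$ gives $\delta$ with $\delta(t)=\sigma(t)$ for $t<i$, $\delta(t)=\sigma(t+j-i)$ for $i\le t<q$, $\delta(t)=\sigma(t+j-k)$ for $q\le t<k$, $\delta(t)=\sigma(t)$ for $k\le t\le n$ (swapping the consecutive blocks $\sigma(i..j-1)$ and $\sigma(j..k-1)$). A full binary tree is a rooted ordered tree whose nodes are leaves or internal nodes with exactly two children. For one with $n$ internal nodes, label internal nodes $1,\dots,n$ in in-order; the associated permutation is the sequence of labels in pre-order. A right rotation at an internal node $a$ whose left child $b$ is internal, with $C,D$ the subtrees of $b$ and $E$ the right subtree of $a$, replaces the subtree at $a$ by the tree with root $b$, left subtree $C$, right child $a$ having subtrees $D,E$; a left rotation is its inverse. $d(T_1,T_2)$ is the minimum number of rotations transforming $T_1$ into $T_2$. A transposition $\delta_{i,j,k}$ is a tree transposition if there exist full binary trees $T_1,T_2$ with $n$ internal nodes, associated permutations $\sigma,\tau$, with $d(T_1,T_2)=1$ and $\delta_{i,j,k}$ applied to $\sigma$ equal to $\tau$. -}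

module Defs where

open import Data.Nat using (ℕ; zero; suc; _+_; _∸_; _≤_; _<_; _<ᵇ_)
open import Data.Bool using (if_then_else_)
open import Data.List using (List; []; _∷_; _++_)
open import Data.Product using (_×_; Σ; ∃; _,_)
open import Data.Sum using (_⊎_)
open import Relation.Binary.PropositionalEquality using (_≡_; _≢_)

data Tree : Set where
  leaf : Tree
  node : Tree → Tree → Tree

size : Tree → ℕ
size leaf       = 0
size (node l r) = suc (size l + size r)

-- Pre-order list of in-order labels; internal nodes of the subtree get labels
-- off+1, …, off+size t (in-order).
preLabels : ℕ → Tree → List ℕ
preLabels off leaf       = []
preLabels off (node l r) =
  suc (off + size l) ∷ (preLabels off l ++ preLabels (suc (off + size l)) r)

assocPerm : Tree → List ℕ
assocPerm t = preLabels 0 t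

-- 1-indexed lookup σ(t) (value 0 outside 1..length)
at : List ℕ → ℕ → ℕ
at []       _             = 0
at (x ∷ xs) zero          = 0
at (x ∷ xs) (suc zero)    = x
at (x ∷ xs) (suc (suc t)) = at xs (suc t)

delta : (ℕ → ℕ) → ℕ → ℕ → ℕ → ℕ → ℕ
delta σ i j k t =
  if t <ᵇ i then σ t
  else if t <ᵇ (k + i ∸ j) then σ (t + j ∸ i)
  else if t <ᵇ k then σ (t + j ∸ k)
  else σ t

data RightRot : Tree → Tree → Set where
  here  : ∀ C D E → RightRot (node (node C D) E) (node C (node D E))
  inL   : ∀ {a b} r → RightRot a b → RightRot (node a r) (node b r)
  inR   : ∀ {a b} l → RightRot a b → RightRot (node l a) (node l b)

OneRot : Tree → Tree → Set
OneRot T₁ T₂ = RightRot T₁ T₂ ⊎ RightRot T₂ T₁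

Dist1 : Tree → Tree → Set
Dist1 T₁ T₂ = T₁ ≢ T₂ × OneRot T₁ T₂

IsTreeTransposition : ℕ → ℕ → ℕ → ℕ → Set
IsTreeTransposition n i j k =
  Σ Tree λ T₁ → Σ Tree λ T₂ →
    size T₁ ≡ n × size T₂ ≡ n × Dist1 T₁ T₂ ×
    (∀ t → 1 ≤ t → t ≤ n →
       delta (at (assocPerm T₁)) i j k t ≡ at (assocPerm T₂) t)

TreeTriple : ℕ → ℕ × ℕ × ℕ → Set
TreeTriple n (i , j , k) =
  1 ≤ i × i < j × j < k × k ≤ suc n × IsTreeTransposition n i j k

-- A right rotation at a node a with left child b turns the pre-order sequence  X a b C D E  into
-- X b C a D E: the label a jumps over the block  b C,  which is the transposition δ_{i,i+1,k}
-- with i - 1 = |X| and k - i - 1 = |b C|; a left rotation is likewise some δ_{i,j,j+1}.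
-- Conversely, δ_{i,j,k} moves σ(j) to position i, while the transposition of a right rotation moves
-- no entry more than one place to the left; as σ is injective, j = i + 1. Symmetrically, δ_{i,j,k}
-- moves σ(j-1) to position k-1 and a left rotation moves no entry more than one place to the right,
-- so k = j + 1. Every such triple is realised by a rotation inside a comb, so the tree transpositions
-- are exactly the triples with j = i + 1 or k = j + 1: n(n-1)/2 + n(n-1)/2 - (n-1) = (n-1)² of them.
module Submission where

open import Defs
open import Data.Bool using (true; false)
open import Data.Bool.Properties using (T-≡)
open import Data.Nat using (ℕ; zero; suc; _+_; _*_; _∸_; _^_; _≤_; _<_; _<ᵇ_; z≤n; s≤s; z<s; s<s; pred)
open import Data.Nat.Properties
open import Data.Nat.Tactic.RingSolver using (solve-∀)
open import Data.List using (List; []; _∷_; _++_; [_]; length; map; upTo)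
open import Data.List.Properties using (length-++; length-map; length-upTo; ++-assoc)
open import Data.List.Membership.Propositional using (_∈_)
open import Data.List.Membership.Propositional.Properties
  using (∈-map⁺; ∈-map⁻; ∈-++⁺ˡ; ∈-++⁺ʳ; ∈-++⁻; ∈-upTo⁺; ∈-upTo⁻)
open import Data.List.Relation.Binary.Disjoint.Propositional using (Disjoint)
open import Data.List.Relation.Unary.Any using (here; there)
open import Data.List.Relation.Unary.All as All using (All)
import Data.List.Relation.Unary.All.Properties as All
open import Data.List.Relation.Unary.AllPairs using ([]; _∷_)
open import Data.List.Relation.Unary.Unique.Propositional using (Unique)
import Data.List.Relation.Unary.Unique.Propositional.Properties as Unique
open import Data.Product using (Σ; _×_; _,_; proj₁; proj₂)
open import Data.Sum using (_⊎_; inj₁; inj₂)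
open import Function using (id; _∘_)
open import Function.Bundles using (Equivalence; _⇔_; mk⇔)
open import Function.Properties.Equivalence using () renaming (trans to ⇔-trans; sym to ⇔-sym)
open import Relation.Binary.PropositionalEquality
  using (_≡_; _≢_; refl; sym; trans; cong; cong₂; subst; module ≡-Reasoning)
open import Relation.Nullary using (contradiction)
open import Relation.Nullary.Reflects using (ofʸ; ofⁿ)

-- The transposition δ, region by region

<ᵇ-true : ∀ {m n} → m < n → (m <ᵇ n) ≡ true
<ᵇ-true m<n = Equivalence.to T-≡ (<⇒<ᵇ m<n)

<ᵇ-false : ∀ {m n} → n ≤ m → (m <ᵇ n) ≡ false
<ᵇ-false {m} {n} n≤m with m <ᵇ n | <ᵇ-reflects-< m n
... | false | _       = refl
... | true  | ofʸ m<n = contradiction n≤m (<⇒≱ m<n)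

module _ (f : ℕ → ℕ) {i j k t : ℕ} where

  delta-before : t < i → delta f i j k t ≡ f t
  delta-before t<i rewrite <ᵇ-true t<i = refl

  delta-first : i ≤ t → t < k + i ∸ j → delta f i j k t ≡ f (t + j ∸ i)
  delta-first i≤t t<q rewrite <ᵇ-false i≤t | <ᵇ-true t<q = refl

  delta-second : i ≤ t → k + i ∸ j ≤ t → t < k → delta f i j k t ≡ f (t + j ∸ k)
  delta-second i≤t q≤t t<k rewrite <ᵇ-false i≤t | <ᵇ-false q≤t | <ᵇ-true t<k = refl

  delta-after : i ≤ t → k + i ∸ j ≤ t → k ≤ t → delta f i j k t ≡ f t
  delta-after i≤t q≤t k≤t rewrite <ᵇ-false i≤t | <ᵇ-false q≤t | <ᵇ-false k≤t = refl

delta-∘ : ∀ f i j k t → delta f i j k t ≡ f (delta id i j k t)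
delta-∘ f i j k t with t <ᵇ i | t <ᵇ (k + i ∸ j) | t <ᵇ k
... | true  | _     | _     = refl
... | false | true  | _     = refl
... | false | false | true  = refl
... | false | false | false = refl

module _ (f : ℕ → ℕ) {i j k : ℕ} where

  delta-start : i < j → j < k → delta f i j k i ≡ f j
  delta-start i<j j<k =
    trans (delta-first f ≤-refl i<q) (cong f (m+n∸m≡n i j))
    where
      i<q : i < k + i ∸ j
      i<q = subst (i <_) (sym (+-∸-comm i (<⇒≤ j<k))) (m<n+m i (m<n⇒0<n∸m j<k))

  delta-end : i ≤ j → j ≤ k → delta f i (suc j) (suc k) k ≡ f j
  delta-end i≤j j≤k =
    trans (delta-second f (≤-trans i≤j j≤k) q≤k (n<1+n k)) (cong f k+1+j∸[1+k]≡j)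
    where
      q≤k : k + i ∸ j ≤ k
      q≤k = ≤-trans (∸-monoˡ-≤ j (+-monoʳ-≤ k i≤j)) (≤-reflexive (m+n∸n≡m k j))
      k+1+j∸[1+k]≡j : k + suc j ∸ suc k ≡ j
      k+1+j∸[1+k]≡j = trans (cong (_∸ suc k) (+-suc k j)) (m+n∸m≡n k j)

module _ (f : ℕ → ℕ) (i u v : ℕ) where

  private
    q≡i+v : i + u + v + i ∸ (i + u) ≡ i + v
    q≡i+v = trans (cong (_∸ (i + u)) (regroup i u v)) (m+n∸m≡n (i + u) (i + v))
      where
        regroup : ∀ i u v → i + u + v + i ≡ (i + u) + (i + v)
        regroup = solve-∀

    i+u+v≡i+[v+u] : i + u + v ≡ i + (v + u)
    i+u+v≡i+[v+u] = trans (+-assoc i u v) (cong (i +_) (+-comm u v))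

  delta-firstBlock : ∀ {s} → s < v → delta f i (i + u) (i + u + v) (i + s) ≡ f (i + (u + s))
  delta-firstBlock {s} s<v =
    trans (delta-first f (m≤m+n i s) (subst (i + s <_) (sym q≡i+v) (+-monoʳ-< i s<v)))
          (cong f (trans (cong (_∸ i) (regroup i u s)) (m+n∸m≡n i (i + (u + s)))))
    where
      regroup : ∀ i u s → i + s + (i + u) ≡ i + (i + (u + s))
      regroup = solve-∀

  delta-secondBlock : ∀ {s} → s < u → delta f i (i + u) (i + u + v) (i + (v + s)) ≡ f (i + s)
  delta-secondBlock {s} s<u =
    trans (delta-second f (m≤m+n i (v + s))
                          (subst (_≤ i + (v + s)) (sym q≡i+v) (+-monoʳ-≤ i (m≤m+n v s)))
                          (subst (i + (v + s) <_) (sym i+u+v≡i+[v+u]) (+-monoʳ-< i (+-monoʳ-< v s<u))))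
          (cong f (trans (cong (_∸ (i + u + v)) (regroup i u v s)) (m+n∸m≡n (i + u + v) (i + s))))
    where
      regroup : ∀ i u v s → i + (v + s) + (i + u) ≡ i + u + v + (i + s)
      regroup = solve-∀

  delta-afterBlocks : ∀ s → delta f i (i + u) (i + u + v) (i + (v + (u + s))) ≡ f (i + (v + (u + s)))
  delta-afterBlocks s =
    delta-after f {j = i + u} (m≤m+n i _)
                  (subst (_≤ i + (v + (u + s))) (sym q≡i+v) (+-monoʳ-≤ i (m≤m+n v (u + s))))
                  (subst (_≤ i + (v + (u + s))) (sym i+u+v≡i+[v+u])
                         (+-monoʳ-≤ i (+-monoʳ-≤ v (m≤m+n u s))))

delta-unitFirstBlock-≤ : ∀ i k t → delta id i (i + 1) k t ≤ suc t
delta-unitFirstBlock-≤ i k t with t <ᵇ i | <ᵇ-reflects-< t i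
... | true  | _        = n≤1+n t
... | false | ofⁿ t≮i with t <ᵇ (k + i ∸ (i + 1))
...   | true  = ≤-reflexive (begin-equality
          t + (i + 1) ∸ i    ≡⟨ +-∸-assoc t (m≤m+n i 1) ⟩
          t + (i + 1 ∸ i)    ≡⟨ cong (t +_) (m+n∸m≡n i 1) ⟩
          t + 1              ≡⟨ +-comm t 1 ⟩
          suc t              ∎)
      where open ≤-Reasoning
...   | false with t <ᵇ k | <ᵇ-reflects-< t k
...     | false | _        = n≤1+n t
...     | true  | ofʸ t<k  = begin
          t + (i + 1) ∸ k        ≤⟨ ∸-monoʳ-≤ (t + (i + 1)) i+1≤k ⟩
          t + (i + 1) ∸ (i + 1)  ≡⟨ m+n∸n≡m t (i + 1) ⟩
          t                      ≤⟨ n≤1+n t ⟩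
          suc t                  ∎
      where
        open ≤-Reasoning
        i+1≤k : i + 1 ≤ k
        i+1≤k = subst (_≤ k) (+-comm 1 i) (≤-<-trans (≮⇒≥ t≮i) t<k)

m≤1+[m+n∸[n+1]] : ∀ m n → m ≤ suc (m + n ∸ (n + 1))
m≤1+[m+n∸[n+1]] zero    n = z≤n
m≤1+[m+n∸[n+1]] (suc m) n = s≤s (≤-reflexive (sym (begin
  suc m + n ∸ (n + 1)  ≡⟨ cong (suc m + n ∸_) (+-comm n 1) ⟩
  m + n ∸ n            ≡⟨ m+n∸n≡m m n ⟩
  m                    ∎)))
  where open ≡-Reasoning

delta-unitSecondBlock-≥ : ∀ i m t → t ≤ suc (delta id i (i + m) (i + m + 1) t)
delta-unitSecondBlock-≥ i m t with t <ᵇ i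
... | true  = n≤1+n t
... | false with t <ᵇ (i + m + 1 + i ∸ (i + m))
...   | true  = begin
          t                       ≤⟨ m≤m+n t m ⟩
          t + m                   ≡⟨ cong (t +_) (m+n∸m≡n i m) ⟨
          t + (i + m ∸ i)         ≡⟨ +-∸-assoc t (m≤m+n i m) ⟨
          t + (i + m) ∸ i         ≤⟨ n≤1+n _ ⟩
          suc (t + (i + m) ∸ i)   ∎
      where open ≤-Reasoning
...   | false with t <ᵇ (i + m + 1)
...     | true  = m≤1+[m+n∸[n+1]] t (i + m)
...     | false = n≤1+n t

-- Lookup in lists

at-++ˡ : ∀ xs ys {t} → t ≤ length xs → at (xs ++ ys) t ≡ at xs t
at-++ˡ []       []      z≤n = refl
at-++ˡ []       (_ ∷ _) z≤n = refl
at-++ˡ (x ∷ xs) ys {zero}        _         = refl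
at-++ˡ (x ∷ xs) ys {suc zero}    _         = refl
at-++ˡ (x ∷ xs) ys {suc (suc t)} (s≤s t<) = at-++ˡ xs ys t<

at-++ʳ : ∀ xs ys t → at (xs ++ ys) (suc (length xs + t)) ≡ at ys (suc t)
at-++ʳ []       ys t = refl
at-++ʳ (x ∷ xs) ys t = at-++ʳ xs ys t

at-∈ : ∀ xs {t} → 0 < at xs t → at xs t ∈ xs
at-∈ (x ∷ xs) {suc zero}    _   = here refl
at-∈ (x ∷ xs) {suc (suc t)} pos = there (at-∈ xs pos)

at-∈-range : ∀ xs {t} → 1 ≤ t → t ≤ length xs → at xs t ∈ xs
at-∈-range (x ∷ xs) {suc zero}    _ _         = here refl
at-∈-range (x ∷ xs) {suc (suc t)} _ (s≤s t<) = there (at-∈-range xs (s≤s z≤n) t<)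

at-injective : ∀ {xs} → Unique xs → ∀ {x y} → 0 < at xs x → at xs x ≡ at xs y → x ≡ y
at-injective {z ∷ zs} (z∉ ∷ _) {suc zero}    {zero}        pos eq = contradiction eq (>⇒≢ pos)
at-injective {z ∷ zs} _        {suc zero}    {suc zero}    pos eq = refl
at-injective {z ∷ zs} (z∉ ∷ _) {suc zero}    {suc (suc y)} pos eq =
  contradiction eq (All.lookup z∉ (at-∈ zs (subst (0 <_) eq pos)))
at-injective {z ∷ zs} (z∉ ∷ _) {suc (suc x)} {zero}        pos eq = contradiction eq (>⇒≢ pos)
at-injective {z ∷ zs} (z∉ ∷ _) {suc (suc x)} {suc zero}    pos eq =
  contradiction (sym eq) (All.lookup z∉ (at-∈ zs pos))
at-injective {z ∷ zs} (_ ∷ U)  {suc (suc x)} {suc (suc y)} pos eq = cong suc (at-injective U pos eq)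

-- The positions of  xs ++ vs ++ us ++ ws,  where i = 1 + length xs, u = length us, v = length vs.
data Blocks (i u v : ℕ) : ℕ → Set where
  before      : ∀ {t} → t < i → Blocks i u v t
  firstBlock  : ∀ {s} → s < v → Blocks i u v (i + s)
  secondBlock : ∀ {s} → s < u → Blocks i u v (i + (v + s))
  afterBlocks : ∀ s → Blocks i u v (i + (v + (u + s)))

data Offset (a : ℕ) : ℕ → Set where
  below : ∀ {t} → t < a → Offset a t
  above : ∀ s → Offset a (a + s)

offset : ∀ a t → Offset a t
offset zero    t       = above t
offset (suc a) zero    = below z<s
offset (suc a) (suc t) with offset a t
... | below t<a = below (s<s t<a)
... | above s   = above s

blocks : ∀ i u v t → Blocks i u v t
blocks i u v t with offset i t
... | below t<i = before t<i
... | above s with offset v s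
...   | below s<v = firstBlock s<v
...   | above s′ with offset u s′
...     | below s′<u = secondBlock s′<u
...     | above s″   = afterBlocks s″

module _ (xs us vs ws : List ℕ) where

  private
    σ = at (xs ++ us ++ vs ++ ws)
    i = suc (length xs)
    u = length us
    v = length vs

  delta-swap : ∀ t → delta σ i (i + u) (i + u + v) t ≡ at (xs ++ vs ++ us ++ ws) t
  delta-swap t with blocks i u v t
  ... | before t<i = begin
    delta σ i (i + u) (i + u + v) t                ≡⟨ delta-before σ {j = i + u} {k = i + u + v} t<i ⟩
    σ t                                            ≡⟨ at-++ˡ xs _ (≤-pred t<i) ⟩
    at xs t                                        ≡⟨ at-++ˡ xs _ (≤-pred t<i) ⟨
    at (xs ++ vs ++ us ++ ws) t                    ∎
    where open ≡-Reasoning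
  ... | firstBlock {s} s<v = begin
    delta σ i (i + u) (i + u + v) (i + s)          ≡⟨ delta-firstBlock σ i u v s<v ⟩
    σ (i + (u + s))                                ≡⟨ at-++ʳ xs _ (u + s) ⟩
    at (us ++ vs ++ ws) (suc (u + s))              ≡⟨ at-++ʳ us _ s ⟩
    at (vs ++ ws) (suc s)                          ≡⟨ at-++ˡ vs ws s<v ⟩
    at vs (suc s)                                  ≡⟨ at-++ˡ vs (us ++ ws) s<v ⟨
    at (vs ++ us ++ ws) (suc s)                    ≡⟨ at-++ʳ xs _ s ⟨
    at (xs ++ vs ++ us ++ ws) (i + s)              ∎
    where open ≡-Reasoning
  ... | secondBlock {s} s<u = begin
    delta σ i (i + u) (i + u + v) (i + (v + s))    ≡⟨ delta-secondBlock σ i u v s<u ⟩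
    σ (i + s)                                      ≡⟨ at-++ʳ xs _ s ⟩
    at (us ++ vs ++ ws) (suc s)                    ≡⟨ at-++ˡ us _ s<u ⟩
    at us (suc s)                                  ≡⟨ at-++ˡ us ws s<u ⟨
    at (us ++ ws) (suc s)                          ≡⟨ at-++ʳ vs _ s ⟨
    at (vs ++ us ++ ws) (suc (v + s))              ≡⟨ at-++ʳ xs _ (v + s) ⟨
    at (xs ++ vs ++ us ++ ws) (i + (v + s))        ∎
    where open ≡-Reasoning
  ... | afterBlocks s = begin
    delta σ i (i + u) (i + u + v) (i + (v + (u + s)))  ≡⟨ delta-afterBlocks σ i u v s ⟩
    σ (i + (v + (u + s)))                          ≡⟨ at-++ʳ xs _ (v + (u + s)) ⟩
    at (us ++ vs ++ ws) (suc (v + (u + s)))        ≡⟨ cong (at (us ++ vs ++ ws) ∘ suc) (exchange v u s) ⟩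
    at (us ++ vs ++ ws) (suc (u + (v + s)))        ≡⟨ at-++ʳ us _ (v + s) ⟩
    at (vs ++ ws) (suc (v + s))                    ≡⟨ at-++ʳ vs _ s ⟩
    at ws (suc s)                                  ≡⟨ at-++ʳ us _ s ⟨
    at (us ++ ws) (suc (u + s))                    ≡⟨ at-++ʳ vs _ (u + s) ⟨
    at (vs ++ us ++ ws) (suc (v + (u + s)))        ≡⟨ at-++ʳ xs _ (v + (u + s)) ⟨
    at (xs ++ vs ++ us ++ ws) (i + (v + (u + s)))  ∎
    where
      open ≡-Reasoning
      exchange : ∀ v u s → v + (u + s) ≡ u + (v + s)
      exchange = solve-∀

InjectiveOn : ℕ → (ℕ → ℕ) → Set
InjectiveOn n f = ∀ {x y} → 1 ≤ x → x ≤ n → f x ≡ f y → x ≡ y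

at-injectiveOn : ∀ {xs} → Unique xs → All (0 <_) xs → InjectiveOn (length xs) (at xs)
at-injectiveOn {xs} U pos 1≤x x≤n = at-injective U (All.lookup pos (at-∈-range xs 1≤x x≤n))

module _ {n : ℕ} {f : ℕ → ℕ} (f-inj : InjectiveOn n f) where

  agree-unitFirstBlock⇒adjacent : ∀ {i j k} i₀ k₀ → 1 ≤ i → i < j → j < k → k ≤ suc n →
    (∀ t → 1 ≤ t → t ≤ n → delta f i j k t ≡ delta f i₀ (i₀ + 1) k₀ t) → j ≡ suc i
  agree-unitFirstBlock⇒adjacent {i} {j} {k} i₀ k₀ 1≤i i<j j<k k≤n+1 agree =
    ≤-antisym (subst (_≤ suc i) (sym j≡) (delta-unitFirstBlock-≤ i₀ k₀ i)) i<j
    where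
      j≤n : j ≤ n
      j≤n = ≤-pred (<-≤-trans j<k k≤n+1)
      j≡ : j ≡ delta id i₀ (i₀ + 1) k₀ i
      j≡ = f-inj (≤-trans 1≤i (<⇒≤ i<j)) j≤n (begin
        f j                           ≡⟨ delta-start f i<j j<k ⟨
        delta f i j k i               ≡⟨ agree i 1≤i (<⇒≤ (<-≤-trans i<j j≤n)) ⟩
        delta f i₀ (i₀ + 1) k₀ i      ≡⟨ delta-∘ f i₀ (i₀ + 1) k₀ i ⟩
        f (delta id i₀ (i₀ + 1) k₀ i) ∎)
        where open ≡-Reasoning

  agree-unitSecondBlock⇒adjacent : ∀ {i j k} i₀ m → 1 ≤ i → i < j → j < k → k ≤ suc n →
    (∀ t → 1 ≤ t → t ≤ n → delta f i j k t ≡ delta f i₀ (i₀ + m) (i₀ + m + 1) t) → suc j ≡ k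
  agree-unitSecondBlock⇒adjacent {i} {suc j} {suc k} i₀ m 1≤i (s≤s i≤j) (s≤s j<k) (s≤s k≤n) agree =
    cong suc (≤-antisym j<k (subst (k ≤_) (cong suc (sym j≡)) (delta-unitSecondBlock-≥ i₀ m k)))
    where
      j≡ : j ≡ delta id i₀ (i₀ + m) (i₀ + m + 1) k
      j≡ = f-inj (≤-trans 1≤i i≤j) (≤-trans (<⇒≤ j<k) k≤n) (begin
        f j                                     ≡⟨ delta-end f i≤j (<⇒≤ j<k) ⟨
        delta f i (suc j) (suc k) k             ≡⟨ agree k (≤-trans 1≤i (≤-trans i≤j (<⇒≤ j<k))) k≤n ⟩
        delta f i₀ (i₀ + m) (i₀ + m + 1) k      ≡⟨ delta-∘ f i₀ (i₀ + m) (i₀ + m + 1) k ⟩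
        f (delta id i₀ (i₀ + m) (i₀ + m + 1) k) ∎)
        where open ≡-Reasoning

-- Pre-order labels and rotations

preLabels-length : ∀ off t → length (preLabels off t) ≡ size t
preLabels-length off leaf       = refl
preLabels-length off (node l r) = cong suc (begin
  length (preLabels off l ++ preLabels _ r)          ≡⟨ length-++ (preLabels off l) ⟩
  length (preLabels off l) + length (preLabels _ r)  ≡⟨ cong₂ _+_ (preLabels-length off l) (preLabels-length _ r) ⟩
  size l + size r                                    ∎)
  where open ≡-Reasoning

root+size : ∀ off l r → suc (off + size l) + size r ≡ off + size (node l r)
root+size off l r = trans (cong suc (+-assoc off (size l) (size r))) (sym (+-suc off _))

Between : ℕ → ℕ → ℕ → Set
Between lo hi v = lo < v × v ≤ hi

Between-mono : ∀ {lo lo′ hi hi′ v} → lo ≤ lo′ → hi′ ≤ hi → Between lo′ hi′ v → Between lo hi v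
Between-mono lo≤ ≤hi (lo′<v , v≤hi′) = ≤-<-trans lo≤ lo′<v , ≤-trans v≤hi′ ≤hi

preLabels-between : ∀ off t → All (Between off (off + size t)) (preLabels off t)
preLabels-between off leaf       = All.[]
preLabels-between off (node l r) =
  (s≤s (m≤m+n off (size l)) , ≤-trans (m≤m+n _ (size r)) right≡)
  All.∷ All.++⁺ (All.map (Between-mono ≤-refl left≤) (preLabels-between off l))
                (All.map (Between-mono (≤-trans (m≤m+n off (size l)) (n≤1+n _)) right≡) (preLabels-between _ r))
  where
    right≡ : suc (off + size l) + size r ≤ off + size (node l r)
    right≡ = ≤-reflexive (root+size off l r)
    left≤ : off + size l ≤ off + size (node l r)
    left≤ = ≤-trans (n≤1+n _) (≤-trans (m≤m+n _ (size r)) right≡)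

preLabels-positive : ∀ off t → All (0 <_) (preLabels off t)
preLabels-positive off t = All.map (≤-<-trans z≤n ∘ proj₁) (preLabels-between off t)

preLabels-unique : ∀ off t → Unique (preLabels off t)
preLabels-unique off leaf       = []
preLabels-unique off (node l r) =
  All.++⁺ (All.map (λ (_ , v≤) → >⇒≢ (s≤s v≤)) (preLabels-between off l))
          (All.map (λ (root<v , _) → <⇒≢ root<v) (preLabels-between _ r))
  ∷ Unique.++⁺ (preLabels-unique off l) (preLabels-unique _ r) separated
  where
    separated : Disjoint (preLabels off l) (preLabels (suc (off + size l)) r)
    separated (v∈l , v∈r) =
      <⇒≱ (<-trans (n<1+n _) (proj₁ (All.lookup (preLabels-between _ r) v∈r)))
          (proj₂ (All.lookup (preLabels-between off l) v∈l))

RightRot-size : ∀ {s t} → RightRot s t → size s ≡ size t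
RightRot-size (here C D E) = cong suc (trans (cong suc (+-assoc (size C) (size D) (size E)))
                                             (sym (+-suc (size C) (size D + size E))))
RightRot-size (inL r h)    = cong (λ x → suc (x + size r)) (RightRot-size h)
RightRot-size (inR l h)    = cong (λ x → suc (size l + x)) (RightRot-size h)

RightRot-≢ : ∀ {s t} → RightRot s t → s ≢ t
RightRot-≢ (here C D E) eq = m≢1+m+n (size C) (sym (cong (size ∘ leftSubtree) eq))
  where
    leftSubtree : Tree → Tree
    leftSubtree leaf       = leaf
    leftSubtree (node l _) = l
RightRot-≢ (inL r h) refl = RightRot-≢ h refl
RightRot-≢ (inR l h) refl = RightRot-≢ h refl

-- In pre-order, a right rotation moves the label of the rotated node past the block made of its
-- left child and that child's left subtree; these are the numbers of labels before it and in the block.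
prefixLength : ∀ {s t} → RightRot s t → ℕ
prefixLength (here _ _ _) = 0
prefixLength (inL _ h)    = suc (prefixLength h)
prefixLength (inR l h)    = suc (size l + prefixLength h)

blockLength : ∀ {s t} → RightRot s t → ℕ
blockLength (here C _ _) = suc (size C)
blockLength (inL _ h)    = blockLength h
blockLength (inR _ h)    = blockLength h

record RotationSplit (off : ℕ) {s t : Tree} (h : RightRot s t) : Set where
  field
    prefix        : List ℕ
    moved         : ℕ
    block         : List ℕ
    rest          : List ℕ
    labels-before : preLabels off s ≡ prefix ++ moved ∷ (block ++ rest)
    labels-after  : preLabels off t ≡ prefix ++ block ++ moved ∷ rest
    prefix-length : length prefix ≡ prefixLength h
    block-length  : length block ≡ blockLength h

rotationSplit : ∀ off {s t} (h : RightRot s t) → RotationSplit off h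
rotationSplit off (here C D E) = record
  { prefix = [] ; moved = a ; block = b ∷ preLabels off C ; rest = preLabels b D ++ preLabels a E
  ; labels-before = cong (λ xs → a ∷ b ∷ xs) (++-assoc (preLabels off C) (preLabels b D) (preLabels a E))
  ; labels-after  = cong (λ x → b ∷ (preLabels off C ++ x ∷ (preLabels b D ++ preLabels x E)))
                         (cong suc (root+size off C D))
  ; prefix-length = refl
  ; block-length  = cong suc (preLabels-length off C)
  }
  where
    a = suc (off + size (node C D))
    b = suc (off + size C)
rotationSplit off (inL {a} {b} r h) = record
  { prefix = ρ ∷ prefix ; moved = moved ; block = block ; rest = rest ++ preLabels ρ r
  ; labels-before = cong (ρ ∷_) (begin
      preLabels off a ++ preLabels ρ r                         ≡⟨ cong (_++ preLabels ρ r) labels-before ⟩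
      (prefix ++ moved ∷ (block ++ rest)) ++ preLabels ρ r     ≡⟨ ++-assoc prefix _ _ ⟩
      prefix ++ moved ∷ ((block ++ rest) ++ preLabels ρ r)     ≡⟨ cong ((prefix ++_) ∘ (moved ∷_)) (++-assoc block rest _) ⟩
      prefix ++ moved ∷ (block ++ rest ++ preLabels ρ r)       ∎)
  ; labels-after = begin
      preLabels off (node b r)                                 ≡⟨ cong (λ x → x ∷ (preLabels off b ++ preLabels x r)) ρ≡ ⟨
      ρ ∷ (preLabels off b ++ preLabels ρ r)                   ≡⟨ cong (λ xs → ρ ∷ (xs ++ preLabels ρ r)) labels-after ⟩
      ρ ∷ ((prefix ++ block ++ moved ∷ rest) ++ preLabels ρ r) ≡⟨ cong (ρ ∷_) (++-assoc prefix _ _) ⟩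
      ρ ∷ (prefix ++ (block ++ moved ∷ rest) ++ preLabels ρ r) ≡⟨ cong ((ρ ∷_) ∘ (prefix ++_)) (++-assoc block _ _) ⟩
      ρ ∷ (prefix ++ block ++ moved ∷ (rest ++ preLabels ρ r)) ∎
  ; prefix-length = cong suc prefix-length
  ; block-length  = block-length
  }
  where
    open ≡-Reasoning
    open RotationSplit (rotationSplit off h)
    ρ = suc (off + size a)
    ρ≡ : ρ ≡ suc (off + size b)
    ρ≡ = cong (λ n → suc (off + n)) (RightRot-size h)
rotationSplit off (inR l h) = record
  { prefix = ρ ∷ (preLabels off l ++ prefix) ; moved = moved ; block = block ; rest = rest
  ; labels-before = cong (ρ ∷_) (trans (cong (preLabels off l ++_) labels-before) (sym (++-assoc (preLabels off l) _ _)))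
  ; labels-after  = cong (ρ ∷_) (trans (cong (preLabels off l ++_) labels-after) (sym (++-assoc (preLabels off l) _ _)))
  ; prefix-length = cong suc (trans (length-++ (preLabels off l))
                                    (cong₂ _+_ (preLabels-length off l) prefix-length))
  ; block-length  = block-length
  }
  where
    ρ = suc (off + size l)
    open RotationSplit (rotationSplit ρ h)

assocPerm-injectiveOn : ∀ T → InjectiveOn (size T) (at (assocPerm T))
assocPerm-injectiveOn T =
  subst (λ n → InjectiveOn n (at (assocPerm T))) (preLabels-length 0 T)
        (at-injectiveOn (preLabels-unique 0 T) (preLabels-positive 0 T))

module _ {s t : Tree} (h : RightRot s t) (off : ℕ) where

  open RotationSplit (rotationSplit off h)

  rightRot-delta : ∀ x → let i = suc (prefixLength h) in
    delta (at (preLabels off s)) i (i + 1) (i + 1 + blockLength h) x ≡ at (preLabels off t) x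
  rightRot-delta x rewrite sym prefix-length | sym block-length | labels-before | labels-after =
    delta-swap prefix [ moved ] block rest x

  leftRot-delta : ∀ x → let i = suc (prefixLength h) in
    delta (at (preLabels off t)) i (i + blockLength h) (i + blockLength h + 1) x ≡ at (preLabels off s) x
  leftRot-delta x rewrite sym prefix-length | sym block-length | labels-before | labels-after =
    delta-swap prefix block [ moved ] rest x

rightRot-isTreeTransposition : ∀ {s t} (h : RightRot s t) {n i j k} → size s ≡ n →
  suc (prefixLength h) ≡ i → i + 1 ≡ j → j + blockLength h ≡ k → IsTreeTransposition n i j k
rightRot-isTreeTransposition {s} {t} h refl refl refl refl =
  s , t , refl , sym (RightRot-size h) , (RightRot-≢ h , inj₁ h) , λ x _ _ → rightRot-delta h 0 x

leftRot-isTreeTransposition : ∀ {s t} (h : RightRot s t) {n i j k} → size s ≡ n →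
  suc (prefixLength h) ≡ i → i + blockLength h ≡ j → j + 1 ≡ k → IsTreeTransposition n i j k
leftRot-isTreeTransposition {s} {t} h refl refl refl refl =
  t , s , sym (RightRot-size h) , refl , (RightRot-≢ h ∘ sym , inj₂ h) , λ x _ _ → leftRot-delta h 0 x

rightSpine : ℕ → Tree → Tree
rightSpine zero    t = t
rightSpine (suc p) t = node leaf (rightSpine p t)

size-rightSpine : ∀ p t → size (rightSpine p t) ≡ p + size t
size-rightSpine zero    t = refl
size-rightSpine (suc p) t = cong suc (size-rightSpine p t)

RightRot-rightSpine : ∀ p {s t} → RightRot s t → RightRot (rightSpine p s) (rightSpine p t)
RightRot-rightSpine zero    h = h
RightRot-rightSpine (suc p) h = inR leaf (RightRot-rightSpine p h)

prefixLength-rightSpine : ∀ p {s t} (h : RightRot s t) →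
  prefixLength (RightRot-rightSpine p h) ≡ p + prefixLength h
prefixLength-rightSpine zero    h = refl
prefixLength-rightSpine (suc p) h = cong suc (prefixLength-rightSpine p h)

blockLength-rightSpine : ∀ p {s t} (h : RightRot s t) →
  blockLength (RightRot-rightSpine p h) ≡ blockLength h
blockLength-rightSpine zero    h = refl
blockLength-rightSpine (suc p) h = blockLength-rightSpine p h

rightComb : ℕ → Tree
rightComb c = rightSpine c leaf

size-rightComb : ∀ c → size (rightComb c) ≡ c
size-rightComb c = trans (size-rightSpine c leaf) (+-identityʳ c)

combRotation : ∀ p c e → RightRot (rightSpine p (node (node (rightComb c) leaf) (rightComb e)))
                                  (rightSpine p (node (rightComb c) (node leaf (rightComb e))))
combRotation p c e = RightRot-rightSpine p (here (rightComb c) leaf (rightComb e))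

combRotation-size : ∀ p c e →
  size (rightSpine p (node (node (rightComb c) leaf) (rightComb e))) ≡ suc (suc p) + c + e
combRotation-size p c e = begin
  size (rightSpine p (node (node (rightComb c) leaf) (rightComb e)))
    ≡⟨ size-rightSpine p _ ⟩
  p + suc (suc (size (rightComb c) + 0) + size (rightComb e))
    ≡⟨ cong₂ (λ x y → p + suc (suc x + y)) (trans (+-identityʳ _) (size-rightComb c)) (size-rightComb e) ⟩
  p + suc (suc c + e)
    ≡⟨ regroup p c e ⟩
  suc (suc p) + c + e ∎
  where
    open ≡-Reasoning
    regroup : ∀ p c e → p + suc (suc c + e) ≡ suc (suc p) + c + e
    regroup = solve-∀

combRotation-prefixLength : ∀ p c e → prefixLength (combRotation p c e) ≡ p
combRotation-prefixLength p c e = trans (prefixLength-rightSpine p _) (+-identityʳ p)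

combRotation-blockLength : ∀ p c e → blockLength (combRotation p c e) ≡ suc c
combRotation-blockLength p c e = trans (blockLength-rightSpine p _) (cong suc (size-rightComb c))

adjacentFirst-isTreeTransposition : ∀ {n i k} → 1 ≤ i → suc i < k → k ≤ suc n →
  IsTreeTransposition n i (suc i) k
adjacentFirst-isTreeTransposition {n} {suc p} _ i+1<k k≤n+1
  with c , refl ← m≤n⇒∃[o]m+o≡n i+1<k
  with e , k+e≡n+1 ← m≤n⇒∃[o]m+o≡n k≤n+1 =
  rightRot-isTreeTransposition (combRotation p c e)
    (trans (combRotation-size p c e) (suc-injective k+e≡n+1))
    (cong suc (combRotation-prefixLength p c e))
    (+-comm (suc p) 1)
    (trans (cong (suc (suc p) +_) (combRotation-blockLength p c e)) (+-suc (suc (suc p)) c))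

adjacentSecond-isTreeTransposition : ∀ {n i j} → 1 ≤ i → i < j → suc j ≤ suc n →
  IsTreeTransposition n i j (suc j)
adjacentSecond-isTreeTransposition {n} {suc p} _ i<j j+1≤n+1
  with c , refl ← m≤n⇒∃[o]m+o≡n i<j
  with e , j+1+e≡n+1 ← m≤n⇒∃[o]m+o≡n j+1≤n+1 =
  leftRot-isTreeTransposition (combRotation p c e)
    (trans (combRotation-size p c e) (suc-injective j+1+e≡n+1))
    (cong suc (combRotation-prefixLength p c e))
    (trans (cong (suc p +_) (combRotation-blockLength p c e)) (+-suc (suc p) c))
    (+-comm (suc (suc p) + c) 1)

-- Tree transpositions and their enumeration

RotationTriple : ℕ → ℕ × ℕ × ℕ → Set
RotationTriple n (i , j , k) = 1 ≤ i × i < j × j < k × k ≤ suc n × (j ≡ suc i ⊎ suc j ≡ k)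

isTreeTransposition⇒adjacent : ∀ {n i j k} → 1 ≤ i → i < j → j < k → k ≤ suc n →
  IsTreeTransposition n i j k → j ≡ suc i ⊎ suc j ≡ k
isTreeTransposition⇒adjacent 1≤i i<j j<k k≤n+1 (T₁ , _ , refl , _ , (_ , inj₁ h) , agree) =
  inj₁ (agree-unitFirstBlock⇒adjacent (assocPerm-injectiveOn T₁)
          (suc (prefixLength h)) (suc (prefixLength h) + 1 + blockLength h) 1≤i i<j j<k k≤n+1
          (λ t 1≤t t≤n → trans (agree t 1≤t t≤n) (sym (rightRot-delta h 0 t))))
isTreeTransposition⇒adjacent 1≤i i<j j<k k≤n+1 (T₁ , _ , refl , _ , (_ , inj₂ h) , agree) =
  inj₂ (agree-unitSecondBlock⇒adjacent (assocPerm-injectiveOn T₁)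
          (suc (prefixLength h)) (blockLength h) 1≤i i<j j<k k≤n+1
          (λ t 1≤t t≤n → trans (agree t 1≤t t≤n) (sym (leftRot-delta h 0 t))))

adjacent⇒isTreeTransposition : ∀ {n i j k} → 1 ≤ i → i < j → j < k → k ≤ suc n →
  j ≡ suc i ⊎ suc j ≡ k → IsTreeTransposition n i j k
adjacent⇒isTreeTransposition 1≤i _   j<k k≤n+1 (inj₁ refl) = adjacentFirst-isTreeTransposition 1≤i j<k k≤n+1
adjacent⇒isTreeTransposition 1≤i i<j _   k≤n+1 (inj₂ refl) = adjacentSecond-isTreeTransposition 1≤i i<j k≤n+1

treeTriple⇔rotationTriple : ∀ n t → TreeTriple n t ⇔ RotationTriple n t
treeTriple⇔rotationTriple n (i , j , k) = mk⇔
  (λ (1≤i , i<j , j<k , k≤n+1 , tt) → 1≤i , i<j , j<k , k≤n+1 , isTreeTransposition⇒adjacent 1≤i i<j j<k k≤n+1 tt)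
  (λ (1≤i , i<j , j<k , k≤n+1 , adj) → 1≤i , i<j , j<k , k≤n+1 , adjacent⇒isTreeTransposition 1≤i i<j j<k k≤n+1 adj)

adjacentFirst adjacentSecond : ℕ → ℕ → ℕ × ℕ × ℕ
adjacentFirst  n i = suc i , suc (suc i) , suc (suc n)
adjacentSecond n i = suc i , suc n , suc (suc n)

adjacentFirstTriples adjacentSecondTriples : ℕ → List (ℕ × ℕ × ℕ)
adjacentFirstTriples  n = map (adjacentFirst n) (upTo n)
adjacentSecondTriples n = map (adjacentSecond n) (upTo (pred n))

rotationTriples : ℕ → List (ℕ × ℕ × ℕ)
rotationTriples zero    = []
rotationTriples (suc n) = rotationTriples n ++ adjacentFirstTriples n ++ adjacentSecondTriples n

rotationTriples-sound : ∀ n {t} → t ∈ rotationTriples n → RotationTriple n t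
rotationTriples-sound (suc n) t∈ with ∈-++⁻ (rotationTriples n) t∈
... | inj₁ t∈old with 1≤i , i<j , j<k , k≤n+1 , adjacent ← rotationTriples-sound n t∈old =
  1≤i , i<j , j<k , m≤n⇒m≤1+n k≤n+1 , adjacent
... | inj₂ t∈new with ∈-++⁻ (adjacentFirstTriples n) t∈new
...   | inj₁ t∈first with i , i<n , refl ← ∈-map⁻ _ t∈first =
  s≤s z≤n , ≤-refl , s≤s (s≤s (∈-upTo⁻ i<n)) , ≤-refl , inj₁ refl
...   | inj₂ t∈second with i , i<n-1 , refl ← ∈-map⁻ _ t∈second =
  s≤s z≤n , s≤s (≤-trans (∈-upTo⁻ i<n-1) pred[n]≤n) , ≤-refl , ≤-refl , inj₂ refl

rotationTriples-complete : ∀ n {t} → RotationTriple n t → t ∈ rotationTriples n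
rotationTriples-complete zero (s≤s z≤n , s≤s (s≤s _) , s≤s (s≤s (s≤s _)) , s≤s () , _)
rotationTriples-complete (suc n) (1≤i , i<j , j<k , k≤n+2 , adjacent) with m≤n⇒m<n∨m≡n k≤n+2
... | inj₁ (s≤s k≤n+1) = ∈-++⁺ˡ (rotationTriples-complete n (1≤i , i<j , j<k , k≤n+1 , adjacent))
... | inj₂ refl = ∈-++⁺ʳ (rotationTriples n) (new 1≤i i<j j<k adjacent)
  where
    new : ∀ {i j} → 1 ≤ i → i < j → j < suc (suc n) → j ≡ suc i ⊎ suc j ≡ suc (suc n) →
          (i , j , suc (suc n)) ∈ adjacentFirstTriples n ++ adjacentSecondTriples n
    new {suc i} _ _ (s≤s (s≤s i<n)) (inj₁ refl) = ∈-++⁺ˡ (∈-map⁺ (adjacentFirst n) (∈-upTo⁺ i<n))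
    new {suc i} _ (s≤s i<n) _ (inj₂ refl) with m≤n⇒m<n∨m≡n i<n
    ... | inj₁ i+1<n =
      ∈-++⁺ʳ (adjacentFirstTriples n) (∈-map⁺ (adjacentSecond n) (∈-upTo⁺ (pred-mono-≤ i+1<n)))
    ... | inj₂ refl  = ∈-++⁺ˡ (∈-map⁺ (adjacentFirst n) (∈-upTo⁺ ≤-refl))

∈-rotationTriples⇔ : ∀ n t → (t ∈ rotationTriples n) ⇔ RotationTriple n t
∈-rotationTriples⇔ n t = mk⇔ (rotationTriples-sound n) (rotationTriples-complete n)

rotationTriples-unique : ∀ n → Unique (rotationTriples n)
rotationTriples-unique zero    = []
rotationTriples-unique (suc n) =
  Unique.++⁺ (rotationTriples-unique n)
             (Unique.++⁺ (Unique.map⁺ (suc-injective ∘ cong proj₁) (Unique.upTo⁺ n))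
                         (Unique.map⁺ (suc-injective ∘ cong proj₁) (Unique.upTo⁺ (pred n)))
                         first∩second)
             old∩new
  where
    first∩second : Disjoint (adjacentFirstTriples n) (adjacentSecondTriples n)
    first∩second (t∈first , t∈second)
      with _ , _ , refl ← ∈-map⁻ (adjacentFirst n) t∈first
      with _ , i<n-1 , refl ← ∈-map⁻ (adjacentSecond n) t∈second =
      <-irrefl refl (∈-upTo⁻ i<n-1)
    old∩new : Disjoint (rotationTriples n) (adjacentFirstTriples n ++ adjacentSecondTriples n)
    old∩new (t∈old , t∈new) with _ , _ , _ , k≤n+1 , _ ← rotationTriples-sound n t∈old
      with ∈-++⁻ (adjacentFirstTriples n) t∈new
    ... | inj₁ t∈first  with _ , _ , refl ← ∈-map⁻ (adjacentFirst n) t∈first   = 1+n≰n k≤n+1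
    ... | inj₂ t∈second with _ , _ , refl ← ∈-map⁻ (adjacentSecond n) t∈second = 1+n≰n k≤n+1

rotationTriples-length : ∀ n → length (rotationTriples n) ≡ (n ∸ 1) ^ 2
rotationTriples-length zero    = refl
rotationTriples-length (suc n) = begin
  length (rotationTriples n ++ adjacentFirstTriples n ++ adjacentSecondTriples n)
    ≡⟨ length-++ (rotationTriples n) ⟩
  length (rotationTriples n) + length (adjacentFirstTriples n ++ adjacentSecondTriples n)
    ≡⟨ cong₂ _+_ (rotationTriples-length n) (length-++ (adjacentFirstTriples n)) ⟩
  (n ∸ 1) ^ 2 + (length (adjacentFirstTriples n) + length (adjacentSecondTriples n))
    ≡⟨ cong ((n ∸ 1) ^ 2 +_) (cong₂ _+_ (trans (length-map _ (upTo n)) (length-upTo n))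
                                        (trans (length-map _ (upTo (pred n))) (length-upTo (pred n)))) ⟩
  (n ∸ 1) ^ 2 + (n + pred n)
    ≡⟨ square-step n ⟩
  n ^ 2 ∎
  where
    open ≡-Reasoning
    square-step : ∀ n → (n ∸ 1) ^ 2 + (n + pred n) ≡ n ^ 2
    square-step zero    = refl
    square-step (suc n) = expand n
      where
        -- The ring solver does not accept _^_, but n ^ 2 reduces to n * (n * 1).
        expand : ∀ n → n * (n * 1) + (suc n + n) ≡ suc n * (suc n * 1)
        expand = solve-∀

lemma4 : (n : ℕ) → 1 ≤ n →
    Σ (List (ℕ × ℕ × ℕ)) λ L →
      Unique L × (∀ t → (t ∈ L) ⇔ TreeTriple n t) × length L ≡ (n ∸ 1) ^ 2
lemma4 n _ =
  rotationTriples n ,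
  rotationTriples-unique n ,
  (λ t → ⇔-trans (∈-rotationTriples⇔ n t) (⇔-sym (treeTriple⇔rotationTriple n t))) ,
  rotationTriples-length n
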